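{- Let $G$ be a connected bridgeless edge-transitive graph with at least one edge. Then $G$ has an orientation $H$ such that $rad(H)\leq rad(G)(g(G)-1)$ and $diam(H)\leq 2\,rad(G)(g(G)-1)$, where $g(G)$ is the girth of $G$.
   Context: Graphs are finite and simple. $G$ is edge-transitive if for any two edges $e_1,e_2$ there is an automorphism of $G$ mapping $e_1$ to $e_2$. The girth $g(G)$ is the length of a shortest cycle. $rad(G)$ is the radius of $G$. An orientation $H$ assigns a direction to each edge; $d_H(x,y)$ is the directed distance, $rad(H)=\min_x\max_y d_H(x,y)$, $diam(H)=\max_{x,y}d_H(x,y)$. -}

module Defs where

open import Data.Nat using (ℕ; zero; suc; _+_; _*_; _∸_; _≤_; _<_)
open import Data.Fin using (Fin)
open import Data.Bool using (Bool; T)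
open import Data.Product using (Σ; ∃; _×_; _,_)
open import Data.Sum using (_⊎_)
open import Relation.Nullary using (¬_)
open import Relation.Binary.PropositionalEquality using (_≡_)
open import Function.Bundles using (_↔_; Inverse; _⇔_)

record Graph (n : ℕ) : Set where
  field
    adj    : Fin n → Fin n → Bool
    sym    : ∀ u v → T (adj u v) → T (adj v u)
    irrefl : ∀ u → ¬ T (adj u u)

  Adj : Fin n → Fin n → Set
  Adj u v = T (adj u v)

open Graph public

data Walk {n : ℕ} (R : Fin n → Fin n → Set) : Fin n → Fin n → ℕ → Set where
  here : ∀ {x} → Walk R x x zero
  step : ∀ {x y z k} → R x y → Walk R y z k → Walk R x z (suc k)

DistLe : ∀ {n} → (Fin n → Fin n → Set) → Fin n → Fin n → ℕ → Set
DistLe R x y k = Σ ℕ λ l → l ≤ k × Walk R x y l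

Connected : ∀ {n} → Graph n → Set
Connected G = ∀ x y → Σ ℕ λ k → Walk (Adj G) x y k

HasEdge : ∀ {n} → Graph n → Set
HasEdge G = Σ _ λ u → Σ _ λ v → Adj G u v

AdjMinus : ∀ {n} → Graph n → Fin n → Fin n → Fin n → Fin n → Set
AdjMinus G u v a b = Adj G a b × ¬ ((a ≡ u × b ≡ v) ⊎ (a ≡ v × b ≡ u))

IsBridge : ∀ {n} → Graph n → Fin n → Fin n → Set
IsBridge G u v = Adj G u v × (∀ k → ¬ Walk (AdjMinus G u v) u v k)

Bridgeless : ∀ {n} → Graph n → Set
Bridgeless G = ∀ u v → ¬ IsBridge G u v

IsAutomorphism : ∀ {n} → Graph n → (Fin n ↔ Fin n) → Set
IsAutomorphism G σ = ∀ a b → Adj G a b ⇔ Adj G (Inverse.to σ a) (Inverse.to σ b)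

EdgeTransitive : ∀ {n} → Graph n → Set
EdgeTransitive G = ∀ u v x y → Adj G u v → Adj G x y →
  Σ (_ ↔ _) λ σ → IsAutomorphism G σ ×
    ((Inverse.to σ u ≡ x × Inverse.to σ v ≡ y) ⊎ (Inverse.to σ u ≡ y × Inverse.to σ v ≡ x))

IsCycle : ∀ {n} → Graph n → ℕ → (ℕ → Fin n) → Set
IsCycle G k f = 3 ≤ k
  × (∀ i j → i < k → j < k → f i ≡ f j → i ≡ j)
  × (∀ i → i < k → Adj G (f i) (f (suc i)))
  × f k ≡ f 0

HasCycleOfLength : ∀ {n} → Graph n → ℕ → Set
HasCycleOfLength G k = Σ (ℕ → _) λ f → IsCycle G k f

IsGirth : ∀ {n} → Graph n → ℕ → Set
IsGirth G g = HasCycleOfLength G g × (∀ k → HasCycleOfLength G k → g ≤ k)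

EccLe : ∀ {n} → (Fin n → Fin n → Set) → Fin n → ℕ → Set
EccLe R x k = ∀ y → DistLe R x y k

RadLe : ∀ {n} → (Fin n → Fin n → Set) → ℕ → Set
RadLe R k = Σ _ λ x → EccLe R x k

DiamLe : ∀ {n} → (Fin n → Fin n → Set) → ℕ → Set
DiamLe R k = ∀ x → EccLe R x k

IsRadius : ∀ {n} → Graph n → ℕ → Set
IsRadius G r = RadLe (Adj G) r × (∀ r' → RadLe (Adj G) r' → r ≤ r')

record Orientation {n : ℕ} (G : Graph n) : Set where
  field
    arc      : Fin n → Fin n → Bool
    arc⇒adj  : ∀ u v → T (arc u v) → Adj G u v
    adj⇒arc  : ∀ u v → Adj G u v → T (arc u v) ⊎ T (arc v u)
    antisym  : ∀ u v → T (arc u v) → ¬ T (arc v u)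

  Arc : Fin n → Fin n → Set
  Arc u v = T (arc u v)

open Orientation public

module Submission where

-- Fix a centre x. Edge-transitivity moves a shortest cycle onto any edge
-- sy, so y reaches s in g − 1 steps without using sy: sy has an "ear"
-- (`edge-ear`). G is then oriented in r rounds (module `Construction`).
-- After m rounds a partial orientation covers a vertex set containing the
-- ball of radius m about x, and each of its vertices reaches x and is
-- reached from x within m(g − 1). A round reaches every unreached neighbour
-- y of this set by orienting part of a shortest walk from y back to the set
-- in G − sy (`AddEar`, `ear-step`); the direction is chosen using two
-- slacks kept for every vertex (`Slack`), so that new vertices stay within
-- (m + 1)(g − 1) of x both ways. Finally the remaining edges are oriented
-- arbitrarily (`complete-orientation`), and any two vertices are joined
-- through x.

open import Defs
open import Data.Nat using (ℕ; zero; suc; _+_; _*_; _∸_; _≤_; _<_; z≤n; s≤s; _⊓_; _≤?_)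
open import Data.Nat.Properties
open import Data.Fin using (Fin) renaming (_≟_ to _≟ᶠ_; _<_ to _<ᶠ_)
open import Data.Bool using (Bool; false; T)
open import Data.Product using (Σ; ∃; _×_; _,_; proj₁; proj₂; swap) renaming (map to ×-map)
open import Data.Sum using (_⊎_; inj₁; inj₂) renaming (map to ⊎-map)
open import Data.Empty using (⊥; ⊥-elim)
open import Function using (flip; _∘_; case_of_)
open import Data.List using (List; []; _∷_; allFin)
open import Data.List.Relation.Unary.Any using () renaming (here to ∈-here; there to ∈-there)
open import Data.List.Membership.Propositional using (_∈_)
open import Data.List.Membership.Propositional.Properties using (∈-allFin)
open import Relation.Nullary using (¬_; Dec; yes; no)
open import Relation.Unary using (Decidable)
open import Relation.Binary.PropositionalEquality using (_≡_; _≢_; refl; trans; cong; subst; module ≡-Reasoning) renaming (sym to ≡-sym)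
open import Relation.Binary.Definitions using (tri<; tri≈; tri>)
open import Relation.Nullary.Decidable using (⌊_⌋; toWitness; fromWitness; T?; _×-dec_; _⊎-dec_; ¬?)
open import Function.Bundles using (_↔_; Inverse; Equivalence; Injection)
open import Function.Properties.Inverse using (↔⇒↣)
open import Data.Fin.Properties using (any?) renaming (<-cmp to <ᶠ-cmp; <-asym to <ᶠ-asym; _<?_ to _<ᶠ?_)

private
  variable
    n k l : ℕ
    R R′ : Fin n → Fin n → Set
    a b c s y : Fin n
    f : ℕ → Fin n

⊓-≤-left : ∀ a b c → a ⊓ b ≤ c → ¬ b ≤ c → a ≤ c
⊓-≤-left a b c a⊓b≤c b≰c with ≤-total a b
... | inj₁ a≤b = subst (_≤ c) (m≤n⇒m⊓n≡m a≤b) a⊓b≤c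
... | inj₂ b≤a = ⊥-elim (b≰c (subst (_≤ c) (m≥n⇒m⊓n≡n b≤a) a⊓b≤c))

round-budget : ∀ m g {γ} → γ ≤ g → m * g + γ ≤ suc m * g
round-budget m g {γ} γ≤g = subst (m * g + γ ≤_) (+-comm (m * g) g) (+-monoʳ-≤ (m * g) γ≤g)

mapʷ : (∀ {u v} → R u v → R′ u v) → Walk R a b k → Walk R′ a b k
mapʷ f here       = here
mapʷ f (step r w) = step (f r) (mapʷ f w)

_++ʷ_ : Walk R a b k → Walk R b c l → Walk R a c (k + l)
here     ++ʷ w′ = w′
step r w ++ʷ w′ = step r (w ++ʷ w′)

snocʷ : Walk R a b k → R b c → Walk R a c (suc k)
snocʷ here        r = step r here
snocʷ (step r′ w) r = step r′ (snocʷ w r)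

reverseʷ : Walk R a b k → Walk (flip R) b a k
reverseʷ here       = here
reverseʷ (step r w) = snocʷ (reverseʷ w) r

unsnocʷ : Walk R a c (suc k) → Σ _ λ b → Walk R a b k × R b c
unsnocʷ (step r here)         = _ , here , r
unsnocʷ (step r (step r′ w)) with unsnocʷ (step r′ w)
... | b , w′ , r″ = b , step r w′ , r″

walk-length-zero : Walk R a b 0 → a ≡ b
walk-length-zero here = refl

-- The j-th vertex of a walk (indices beyond the length give the last vertex).
vertexAt : Walk {n = n} R a b k → ℕ → Fin n
vertexAt {a = a} here       _       = a
vertexAt {a = a} (step _ _) zero    = a
vertexAt         (step _ w) (suc j) = vertexAt w j

vertexAt-start : (w : Walk R a b k) → vertexAt w 0 ≡ a
vertexAt-start here       = refl
vertexAt-start (step _ _) = refl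

vertexAt-end : (w : Walk R a b k) → vertexAt w k ≡ b
vertexAt-end here       = refl
vertexAt-end (step _ w) = vertexAt-end w

vertexAt-step : (w : Walk R a b k) → ∀ j → j < k → R (vertexAt w j) (vertexAt w (suc j))
vertexAt-step {R = R} (step {x = a} r w) zero _ = subst (R a) (≡-sym (vertexAt-start w)) r
vertexAt-step (step r w) (suc j) (s≤s j<k) = vertexAt-step w j j<k

prefixʷ : (w : Walk R a b k) → ∀ j → j ≤ k → Walk R a (vertexAt w j) j
prefixʷ here       zero    _         = here
prefixʷ (step r w) zero    _         = here
prefixʷ (step r w) (suc j) (s≤s j≤k) = step r (prefixʷ w j j≤k)

suffixʷ : (w : Walk R a b k) → ∀ j → j ≤ k → Walk R (vertexAt w j) b (k ∸ j)
suffixʷ here       zero    _         = here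
suffixʷ (step r w) zero    _         = step r w
suffixʷ (step r w) (suc j) (s≤s j≤k) = suffixʷ w j j≤k

reachable? : (∀ u v → Dec (R u v)) → (S : Fin n → Bool) →
             ∀ L u → Dec (Σ _ λ t → T (S t) × Walk R u t L)
reachable? R? S zero u with T? (S u)
... | yes u∈S = yes (u , u∈S , here)
... | no  u∉S = no λ { (_ , t∈S , here) → u∉S t∈S }
reachable? R? S (suc L) u with any? (λ v → R? u v ×-dec reachable? R? S L v)
... | yes (_ , r , t , t∈S , w) = yes (t , t∈S , step r w)
... | no  none                  = no λ { (t , t∈S , step r w) → none (_ , r , t , t∈S , w) }

dist-map : (∀ {u v} → R u v → R′ u v) → DistLe R a b k → DistLe R′ a b k
dist-map f (l , l≤k , w) = l , l≤k , mapʷ f w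

dist-weaken : k ≤ l → DistLe R a b k → DistLe R a b l
dist-weaken k≤l (m , m≤k , w) = m , ≤-trans m≤k k≤l , w

dist-trans : DistLe R a b k → DistLe R b c l → DistLe R a c (k + l)
dist-trans (k′ , k′≤k , w) (l′ , l′≤l , w′) = k′ + l′ , +-mono-≤ k′≤k l′≤l , w ++ʷ w′

dist-reverse : DistLe R a b k → DistLe (flip R) b a k
dist-reverse (l , l≤k , w) = l , l≤k , reverseʷ w

module _ {P : ℕ → Set} (P? : Decidable P) where
  private
    searchBelow : ∀ k → (Σ ℕ λ m → m < k × P m × (∀ l → l < m → ¬ P l))
                        ⊎ (∀ l → l < k → ¬ P l)
    searchBelow zero = inj₂ λ _ ()
    searchBelow (suc k) with searchBelow k | P? k
    ... | inj₁ (m , m<k , pm , below) | _      = inj₁ (m , m≤n⇒m≤1+n m<k , pm , below)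
    ... | inj₂ none                   | yes pk = inj₁ (k , ≤-refl , pk , none)
    ... | inj₂ none                   | no ¬pk = inj₂ λ l l<1+k →
      case m≤n⇒m<n∨m≡n (≤-pred l<1+k) of λ where
        (inj₁ l<k)  → none l l<k
        (inj₂ refl) → ¬pk

  leastWitness : ∀ k → P k → Σ ℕ λ m → m ≤ k × P m × (∀ l → l < m → ¬ P l)
  leastWitness k pk with searchBelow (suc k)
  ... | inj₁ (m , m<1+k , pm , below) = m , ≤-pred m<1+k , pm , below
  ... | inj₂ none                     = ⊥-elim (none k ≤-refl pk)

OnEdge : Fin n → Fin n → Fin n → Fin n → Set
OnEdge s y a b = (a ≡ s × b ≡ y) ⊎ (a ≡ y × b ≡ s)

onEdge? : ∀ (s y a b : Fin n) → Dec (OnEdge s y a b)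
onEdge? s y a b = ((a ≟ᶠ s) ×-dec (b ≟ᶠ y)) ⊎-dec ((a ≟ᶠ y) ×-dec (b ≟ᶠ s))

module _ (G : Graph n) where

  minus-sym : AdjMinus G s y a b → AdjMinus G s y b a
  minus-sym (ab , ¬e) = Graph.sym G _ _ ab , λ where
    (inj₁ (p , q)) → ¬e (inj₂ (q , p))
    (inj₂ (p , q)) → ¬e (inj₁ (q , p))

  minus-swap : AdjMinus G s y a b → AdjMinus G y s a b
  minus-swap (ab , ¬e) = ab , λ where
    (inj₁ e) → ¬e (inj₂ e)
    (inj₂ e) → ¬e (inj₁ e)

  minus? : ∀ s y a b → Dec (AdjMinus G s y a b)
  minus? s y a b = T? (adj G a b) ×-dec ¬? (onEdge? s y a b)

  reverse-minus : Walk (AdjMinus G s y) a b k → Walk (AdjMinus G s y) b a k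
  reverse-minus w = mapʷ minus-sym (reverseʷ w)

  cycle-ear : IsCycle G k f → Walk (AdjMinus G (f 0) (f 1)) (f 1) (f 0) (k ∸ 1)
  cycle-ear {k} {f} (3≤k , inj , adj , closed) =
    subst (λ v → Walk (AdjMinus G (f 0) (f 1)) (f 1) v (k ∸ 1)) closed
          (along (k ∸ 1) 1 ≤-refl (m+[n∸m]≡n (≤-trans (s≤s z≤n) 3≤k)))
    where
      -- the cycle edges f i f (i+1) with 1 ≤ i < k differ from f 0 f 1,
      -- since the cycle visits f 0, f 1 and f 2 only once
      avoids : ∀ i → 1 ≤ i → i < k → ¬ OnEdge (f 0) (f 1) (f i) (f (suc i))
      avoids i 1≤i i<k (inj₁ (i≈0 , _)) with inj i 0 i<k (≤-trans (s≤s z≤n) 3≤k) i≈0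
      ... | refl = 1+n≰n 1≤i
      avoids i 1≤i i<k (inj₂ (i≈1 , i+1≈0)) with inj i 1 i<k (≤-trans (s≤s (s≤s z≤n)) 3≤k) i≈1
      ... | refl with inj 2 0 3≤k (≤-trans (s≤s z≤n) 3≤k) i+1≈0
      ... | ()
      along : ∀ d i → 1 ≤ i → i + d ≡ k → Walk (AdjMinus G (f 0) (f 1)) (f i) (f k) d
      along zero    i _   i+0≡k =
        subst (λ j → Walk _ (f i) (f j) 0) (trans (≡-sym (+-identityʳ i)) i+0≡k) here
      along (suc d) i 1≤i i+d≡k = step (adj i i<k , avoids i 1≤i i<k)
                                       (along d (suc i) (s≤s z≤n) (trans (≡-sym (+-suc i d)) i+d≡k))
        where
          i<k : i < k
          i<k = subst (i <_) i+d≡k (m<m+n i (s≤s z≤n))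

  cycle-image : (σ : Fin n ↔ Fin n) → IsAutomorphism G σ → IsCycle G k f → IsCycle G k (Inverse.to σ ∘ f)
  cycle-image σ aut (3≤k , inj , adj , closed) =
      3≤k
    , (λ i j i<k j<k σfi≡σfj → inj i j i<k j<k (Injection.injective (↔⇒↣ σ) σfi≡σfj))
    , (λ i i<k → Equivalence.to (aut _ _) (adj i i<k))
    , cong (Inverse.to σ) closed

  ear-of-cycle : IsCycle G k f → OnEdge s y (f 0) (f 1) → Walk (AdjMinus G s y) y s (k ∸ 1)
  ear-of-cycle c (inj₁ (refl , refl)) = cycle-ear c
  ear-of-cycle c (inj₂ (refl , refl)) = mapʷ minus-swap (reverse-minus (cycle-ear c))

  edge-ear : EdgeTransitive G → HasCycleOfLength G k → Adj G s y → Walk (AdjMinus G s y) y s (k ∸ 1)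
  edge-ear {s = s} {y = y} et (f , c@(3≤k , _ , adj , _)) sy
    with et (f 0) (f 1) s y (adj 0 (≤-trans (s≤s z≤n) 3≤k)) sy
  ... | σ , aut , ends = ear-of-cycle (cycle-image σ aut c) ends

-- Any antisymmetric choice of directions on some edges of G extends to an
-- orientation of G: the remaining edges point from smaller to larger index.
complete-orientation : (G : Graph n) (A : Fin n → Fin n → Bool) →
  (∀ u v → T (A u v) → Adj G u v) → (∀ u v → T (A u v) → ¬ T (A v u)) →
  Σ (Orientation G) λ H → ∀ u v → T (A u v) → Arc H u v
complete-orientation {n} G A A⇒adj A-antisym = H , λ u v a → fromWitness (inj₁ a)
  where
    Completed : Fin n → Fin n → Set
    Completed u v = T (A u v) ⊎ (Adj G u v × ¬ T (A v u) × u <ᶠ v)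

    completed? : ∀ u v → Dec (Completed u v)
    completed? u v = T? (A u v) ⊎-dec (T? (adj G u v) ×-dec ¬? (T? (A v u)) ×-dec (u <ᶠ? v))

    completed⇒adj : ∀ u v → Completed u v → Adj G u v
    completed⇒adj u v (inj₁ a)           = A⇒adj u v a
    completed⇒adj u v (inj₂ (uv , _ , _)) = uv

    adj⇒completed : ∀ u v → Adj G u v → Completed u v ⊎ Completed v u
    adj⇒completed u v uv with T? (A u v) | T? (A v u) | <ᶠ-cmp u v
    ... | yes a | _     | _             = inj₁ (inj₁ a)
    ... | no _  | yes a | _             = inj₂ (inj₁ a)
    ... | no ¬a | no ¬b | tri< u<v _ _  = inj₁ (inj₂ (uv , ¬b , u<v))
    ... | no _  | no _  | tri≈ _ refl _ = ⊥-elim (Graph.irrefl G u uv)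
    ... | no ¬a | no ¬b | tri> _ _ v<u  = inj₂ (inj₂ (Graph.sym G u v uv , ¬a , v<u))

    completed-antisym : ∀ u v → Completed u v → ¬ Completed v u
    completed-antisym u v (inj₁ a)             (inj₁ b)             = A-antisym u v a b
    completed-antisym u v (inj₁ a)             (inj₂ (_ , ¬a , _))  = ¬a a
    completed-antisym u v (inj₂ (_ , ¬b , _))  (inj₁ b)             = ¬b b
    completed-antisym u v (inj₂ (_ , _ , u<v)) (inj₂ (_ , _ , v<u)) = <ᶠ-asym u<v v<u

    H : Orientation G
    H = record
      { arc     = λ u v → ⌊ completed? u v ⌋
      ; arc⇒adj = λ u v h → completed⇒adj u v (toWitness h)
      ; adj⇒arc = λ u v uv → ⊎-map fromWitness fromWitness (adj⇒completed u v uv)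
      ; antisym = λ u v h h′ → completed-antisym u v (toWitness h) (toWitness h′)
      }

_⊆ᵇ_ : (Fin n → Bool) → (Fin n → Bool) → Set
D ⊆ᵇ D′ = ∀ u → T (D u) → T (D′ u)

module Construction (G : Graph n) (x : Fin n) (g′ : ℕ) where

  -- A set of reached vertices together with directions on some of the
  -- edges inside it: a partial orientation of G supported on that set.
  record Explored : Set where
    field
      reached          : Fin n → Bool
      oriented         : Fin n → Fin n → Bool
      oriented⇒adj     : ∀ u v → T (oriented u v) → Adj G u v
      oriented⇒reached : ∀ u v → T (oriented u v) → T (reached u) × T (reached v)
      oriented-antisym : ∀ u v → T (oriented u v) → ¬ T (oriented v u)

    Reached : Fin n → Set
    Reached u = T (reached u)

    Oriented : Fin n → Fin n → Set
    Oriented u v = T (oriented u v)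

  reverse-explored : Explored → Explored
  reverse-explored E = record
    { reached          = reached
    ; oriented         = flip oriented
    ; oriented⇒adj     = λ u v a → Graph.sym G v u (oriented⇒adj v u a)
    ; oriented⇒reached = λ u v a → swap (oriented⇒reached v u a)
    ; oriented-antisym = λ u v a b → oriented-antisym v u a b
    }
    where open Explored E

  FarFrom : (Fin n → Bool) → Fin n → ℕ → Set
  FarFrom S u k = ∀ L t → T (S t) → Walk (Adj G) u t L → k ≤ L

  -- The invariant kept for a reached vertex u during a phase whose seeds S
  -- lie within M of x in both directions: x reaches u within M + α, u
  -- reaches x within M + β, both slacks are at most g′, and u is at
  -- distance at least min(α, β) from the seeds.
  record Slack (Arcs : Fin n → Fin n → Set) (S : Fin n → Bool) (M : ℕ) (u : Fin n) : Set where
    field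
      α β    : ℕ
      α≤g′   : α ≤ g′
      β≤g′   : β ≤ g′
      from-x : DistLe Arcs x u (M + α)
      to-x   : DistLe Arcs u x (M + β)
      far    : FarFrom S u (α ⊓ β)

  slack-map : ∀ {Arcs Arcs′ S M u} → (∀ {a b} → Arcs a b → Arcs′ a b) → Slack Arcs S M u → Slack Arcs′ S M u
  slack-map f σ = record
    { α = α ; β = β ; α≤g′ = α≤g′ ; β≤g′ = β≤g′
    ; from-x = dist-map f from-x ; to-x = dist-map f to-x ; far = far }
    where open Slack σ

  slack-reverse : ∀ {Arcs S M u} → Slack Arcs S M u → Slack (flip Arcs) S M u
  slack-reverse {S = S} {u = u} σ = record
    { α = β ; β = α ; α≤g′ = β≤g′ ; β≤g′ = α≤g′
    ; from-x = dist-reverse to-x ; to-x = dist-reverse from-x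
    ; far = subst (FarFrom S u) (⊓-comm α β) far }
    where open Slack σ

  record PhaseState (S : Fin n → Bool) (M : ℕ) : Set where
    field
      explored : Explored
    open Explored explored public
    field
      seeds-reached : ∀ u → T (S u) → Reached u
      seeds-close   : ∀ u → T (S u) → DistLe Oriented x u M × DistLe Oriented u x M
      slack         : ∀ u → Reached u → Slack Oriented S M u

  reverse-phase : ∀ {S M} → PhaseState S M → PhaseState S M
  reverse-phase st = record
    { explored      = reverse-explored explored
    ; seeds-reached = seeds-reached
    ; seeds-close   = λ u u∈S → swap (×-map dist-reverse dist-reverse (seeds-close u u∈S))
    ; slack         = λ u r → slack-reverse (slack u r)
    }
    where open PhaseState st

  module ShortestEar (S : Fin n → Bool) {s y : Fin n} (s∈S : T (S s))
                     {K : ℕ} {t : Fin n} (P : Walk (AdjMinus G s y) y t K) (t∈S : T (S t))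
                     (no-shorter : ∀ L → L < K → ¬ (Σ _ λ t′ → T (S t′) × Walk (AdjMinus G s y) y t′ L))
                     where

    shortest : ∀ L t′ → T (S t′) → Walk (AdjMinus G s y) y t′ L → K ≤ L
    shortest L t′ t′∈S w = ≮⇒≥ λ L<K → no-shorter L L<K (t′ , t′∈S , w)

    at : ℕ → Fin n
    at = vertexAt P

    far-along : ∀ j → j ≤ K → ∀ {t′ L} → T (S t′) → Walk (AdjMinus G s y) (at j) t′ L → K ∸ j ≤ L
    far-along j j≤K t′∈S w = m≤n+o⇒m∸n≤o K j (shortest _ _ t′∈S (prefixʷ P j j≤K ++ʷ w))

    far-from-y : ∀ j → j ≤ K → ∀ {L} → Walk (AdjMinus G s y) (at j) y L → j ≤ L
    far-from-y j j≤K {L} w = subst (_≤ L) (m∸[m∸n]≡n j≤K)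
      (m≤n+o⇒m∸n≤o K (K ∸ j) (subst (K ≤_) (+-comm L (K ∸ j))
        (shortest _ t t∈S (reverse-minus G w ++ʷ suffixʷ P j j≤K))))

    first-crossing : ∀ {u t′ L} → T (S t′) → Walk (Adj G) u t′ L →
        (Σ ℕ λ L′ → L′ ≤ L × Σ _ λ t″ → T (S t″) × Walk (AdjMinus G s y) u t″ L′)
      ⊎ (Σ ℕ λ L′ → L′ < L × Walk (AdjMinus G s y) u y L′)
    first-crossing {t′ = t′} t′∈S here = inj₁ (0 , z≤n , t′ , t′∈S , here)
    first-crossing t′∈S (step {x = u} {y = v} uv w) with onEdge? s y u v | first-crossing t′∈S w
    ... | yes (inj₁ (refl , _)) | _ = inj₁ (0 , z≤n , s , s∈S , here)
    ... | yes (inj₂ (refl , _)) | _ = inj₂ (0 , s≤s z≤n , here)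
    ... | no ¬e | inj₁ (L′ , L′≤L , t″ , t″∈S , w′) = inj₁ (suc L′ , s≤s L′≤L , t″ , t″∈S , step (uv , ¬e) w′)
    ... | no ¬e | inj₂ (L′ , L′<L , w′)             = inj₂ (suc L′ , s≤s L′<L , step (uv , ¬e) w′)

    vertex-far : ∀ j → j ≤ K → FarFrom S (at j) (suc j ⊓ (K ∸ j))
    vertex-far j j≤K L t′ t′∈S w with first-crossing t′∈S w
    ... | inj₁ (L′ , L′≤L , _ , t″∈S , w′) =
      ≤-trans (m⊓n≤n (suc j) (K ∸ j)) (≤-trans (far-along j j≤K t″∈S w′) L′≤L)
    ... | inj₂ (L′ , L′<L , w′) =
      ≤-trans (m⊓n≤m (suc j) (K ∸ j)) (≤-trans (s≤s (far-from-y j j≤K w′)) L′<L)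

    -- P is a path: a repeated vertex would give a shortcut to S.
    earlier-differs : ∀ {i j} → i < j → j ≤ K → at i ≢ at j
    earlier-differs {i} {j} i<j j≤K eq = <⇒≱ (∸-monoʳ-< i<j j≤K)
      (far-along i (≤-trans (<⇒≤ i<j) j≤K) t∈S
        (subst (λ v → Walk (AdjMinus G s y) v t (K ∸ j)) (≡-sym eq) (suffixʷ P j j≤K)))

    path-injective : ∀ i j → i ≤ K → j ≤ K → at i ≡ at j → i ≡ j
    path-injective i j i≤K j≤K eq with <-cmp i j
    ... | tri< i<j _ _ = ⊥-elim (earlier-differs i<j j≤K eq)
    ... | tri≈ _ i≡j _ = i≡j
    ... | tri> _ _ j<i = ⊥-elim (earlier-differs j<i i≤K (≡-sym eq))

  -- Let s be a seed, y an unreached neighbour of s, P a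
  -- shortest walk P₀ = y, …, P_K in G − sy from y to the seeds (K ≤ g′),
  -- and z = P_p its first
  -- reached vertex, with return slack β_z ≤ K − p. Orienting
  -- s → P₀ → ⋯ → P_p keeps all invariants: the new vertices P_j (j < p)
  -- get slacks (j + 1, K − j).
  module AddEar {S : Fin n → Bool} {M : ℕ} (st : PhaseState S M)
                {s y : Fin n} (s∈S : T (S s)) (sy : Adj G s y) (y-new : ¬ PhaseState.Reached st y)
                {K : ℕ} {t : Fin n} (P : Walk (AdjMinus G s y) y t K) (t∈S : T (S t))
                (no-shorter : ∀ L → L < K → ¬ (Σ _ λ t′ → T (S t′) × Walk (AdjMinus G s y) y t′ L))
                (K≤g′ : K ≤ g′)
                {p : ℕ} (p≤K : p ≤ K) (p-reached : PhaseState.Reached st (vertexAt P p))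
                (p-first : ∀ j → j < p → ¬ PhaseState.Reached st (vertexAt P j))
                {βz : ℕ} (βz≤ : βz ≤ K ∸ p) (z→x : DistLe (PhaseState.Oriented st) (vertexAt P p) x (M + βz))
                where
    open PhaseState st
    open ShortestEar S s∈S P t∈S no-shorter

    ear : ℕ → Fin n
    ear zero    = s
    ear (suc j) = at j

    s-reached : Reached s
    s-reached = seeds-reached s s∈S

    y-unreached : ¬ Reached (ear 1)
    y-unreached r = y-new (subst Reached (vertexAt-start P) r)

    -- y = P₀ is new, so the ear has at least one new vertex.
    1≤p : 1 ≤ p
    1≤p = positive p p-reached
      where
        positive : ∀ q → Reached (at q) → 1 ≤ q
        positive zero    r = ⊥-elim (y-unreached r)
        positive (suc _) _ = s≤s z≤n

    ear-adj : ∀ i → i ≤ p → Adj G (ear i) (ear (suc i))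
    ear-adj zero    _   = subst (Adj G s) (≡-sym (vertexAt-start P)) sy
    ear-adj (suc j) j<p = proj₁ (vertexAt-step P j (<-≤-trans j<p p≤K))

    second-vertex-not-s : at 1 ≢ s
    second-vertex-not-s at1≡s =
      proj₂ (vertexAt-step P 0 (≤-trans 1≤p p≤K)) (inj₂ (vertexAt-start P , at1≡s))

    ear-reached : ∀ i → i ≤ suc p → Reached (ear i) → i ≡ 0 ⊎ i ≡ suc p
    ear-reached zero    _         _ = inj₁ refl
    ear-reached (suc j) (s≤s j≤p) r with m≤n⇒m<n∨m≡n j≤p
    ... | inj₁ j<p  = ⊥-elim (p-first j j<p r)
    ... | inj₂ refl = inj₂ refl

    inner-reached : ∀ i → i ≤ p → Reached (ear i) → i ≡ 0
    inner-reached i i≤p r with ear-reached i (m≤n⇒m≤1+n i≤p) r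
    ... | inj₁ i≡0  = i≡0
    ... | inj₂ refl = ⊥-elim (1+n≰n i≤p)

    ear-injective : ∀ i j → i ≤ suc p → j ≤ suc p → ¬ Reached (ear i) → ear i ≡ ear j → i ≡ j
    ear-injective zero    _       _         _         ¬r _  = ⊥-elim (¬r s-reached)
    ear-injective (suc i) zero    _         _         ¬r eq = ⊥-elim (¬r (subst Reached (≡-sym eq) s-reached))
    ear-injective (suc i) (suc j) (s≤s i≤p) (s≤s j≤p) ¬r eq =
      cong suc (path-injective i j (≤-trans i≤p p≤K) (≤-trans j≤p p≤K) eq)

    ear-edge-new : ∀ i → i ≤ p → Reached (ear i) → Reached (ear (suc i)) → ⊥
    ear-edge-new i i≤p r r′ with inner-reached i i≤p r
    ... | refl with ear-reached 1 (s≤s z≤n) r′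
    ...   | inj₁ ()
    ...   | inj₂ 1≡1+p = <⇒≢ 1≤p (suc-injective 1≡1+p)

    ear-not-reversed : ∀ i j → i ≤ p → j ≤ p → ear i ≡ ear (suc j) → ear (suc i) ≡ ear j → ⊥
    ear-not-reversed i j i≤p j≤p e₁ e₂ with T? (reached (ear i))
    ... | yes r with inner-reached i i≤p r
    ...   | refl with ear-injective 1 j (s≤s z≤n) (m≤n⇒m≤1+n j≤p) y-unreached e₂
    ...     | refl = second-vertex-not-s (≡-sym e₁)
    ear-not-reversed i j i≤p j≤p e₁ e₂ | no ¬r
      with ear-injective i (suc j) (m≤n⇒m≤1+n i≤p) (s≤s j≤p) ¬r e₁
    ... | refl with T? (reached (ear j))
    ...   | yes r′ with inner-reached j j≤p r′
    ...     | refl = second-vertex-not-s e₂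
    ear-not-reversed i j i≤p j≤p e₁ e₂ | no ¬r | refl | no ¬r′ =
      <⇒≢ (m<n⇒m<1+n (n<1+n j))
          (ear-injective j (suc (suc j)) (m≤n⇒m≤1+n j≤p) (s≤s i≤p) ¬r′ (≡-sym e₂))

    EarArc : Fin n → Fin n → Set
    EarArc u v = ∃ λ i → i < suc p × ear i ≡ u × ear (suc i) ≡ v

    NewVertex : Fin n → Set
    NewVertex u = ∃ λ j → j < p × at j ≡ u

    reached′ : Fin n → Bool
    reached′ u = ⌊ T? (reached u) ⊎-dec anyUpTo? (λ j → at j ≟ᶠ u) p ⌋

    oriented′ : Fin n → Fin n → Bool
    oriented′ u v = ⌊ T? (oriented u v) ⊎-dec anyUpTo? (λ i → (ear i ≟ᶠ u) ×-dec (ear (suc i) ≟ᶠ v)) (suc p) ⌋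

    Oriented′ : Fin n → Fin n → Set
    Oriented′ u v = T (oriented′ u v)

    old-reached : ∀ {u} → Reached u → T (reached′ u)
    old-reached r = fromWitness (inj₁ r)

    old-arc : ∀ {u v} → Oriented u v → Oriented′ u v
    old-arc a = fromWitness (inj₁ a)

    ear-arc : ∀ i → i ≤ p → Oriented′ (ear i) (ear (suc i))
    ear-arc i i≤p = fromWitness (inj₂ (i , s≤s i≤p , refl , refl))

    ear-vertex-reached : ∀ i → i ≤ suc p → T (reached′ (ear i))
    ear-vertex-reached zero    _         = old-reached s-reached
    ear-vertex-reached (suc j) (s≤s j≤p) with m≤n⇒m<n∨m≡n j≤p
    ... | inj₁ j<p  = fromWitness (inj₂ (j , j<p , refl))
    ... | inj₂ refl = old-reached p-reached

    explored′ : Explored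
    explored′ = record
      { reached          = reached′
      ; oriented         = oriented′
      ; oriented⇒adj     = λ u v a → ear∪old⇒adj u v (toWitness a)
      ; oriented⇒reached = λ u v a → ear∪old⇒reached u v (toWitness a)
      ; oriented-antisym = λ u v a b → ear∪old-antisym u v (toWitness a) (toWitness b)
      }
      where
        ear∪old⇒adj : ∀ u v → Oriented u v ⊎ EarArc u v → Adj G u v
        ear∪old⇒adj u v (inj₁ a)                         = oriented⇒adj u v a
        ear∪old⇒adj _ _ (inj₂ (i , s≤s i≤p , refl , refl)) = ear-adj i i≤p

        ear∪old⇒reached : ∀ u v → Oriented u v ⊎ EarArc u v → T (reached′ u) × T (reached′ v)
        ear∪old⇒reached u v (inj₁ a) =
          ×-map old-reached old-reached (oriented⇒reached u v a)
        ear∪old⇒reached _ _ (inj₂ (i , s≤s i≤p , refl , refl)) =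
          ear-vertex-reached i (m≤n⇒m≤1+n i≤p) , ear-vertex-reached (suc i) (s≤s i≤p)

        ear∪old-antisym : ∀ u v → Oriented u v ⊎ EarArc u v → ¬ (Oriented v u ⊎ EarArc v u)
        ear∪old-antisym u v (inj₁ a) (inj₁ b) = oriented-antisym u v a b
        ear∪old-antisym _ _ (inj₁ a) (inj₂ (i , s≤s i≤p , refl , refl)) =
          ear-edge-new i i≤p (proj₂ (oriented⇒reached _ _ a)) (proj₁ (oriented⇒reached _ _ a))
        ear∪old-antisym _ _ (inj₂ (i , s≤s i≤p , refl , refl)) (inj₁ b) =
          ear-edge-new i i≤p (proj₂ (oriented⇒reached _ _ b)) (proj₁ (oriented⇒reached _ _ b))
        ear∪old-antisym u v (inj₂ (i , s≤s i≤p , e₁ , e₂)) (inj₂ (j , s≤s j≤p , e₁′ , e₂′)) =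
          ear-not-reversed i j i≤p j≤p (trans e₁ (≡-sym e₂′)) (trans e₂ (≡-sym e₁′))

    ear-walk : ∀ d i j → i + d ≡ j → j ≤ suc p → Walk Oriented′ (ear i) (ear j) d
    ear-walk zero    i j i+0≡j _  =
      subst (λ k → Walk Oriented′ (ear i) (ear k) 0) (trans (≡-sym (+-identityʳ i)) i+0≡j) here
    ear-walk (suc d) i j i+d≡j j≤ =
      step (ear-arc i i≤p) (ear-walk d (suc i) j (trans (≡-sym (+-suc i d)) i+d≡j) j≤)
      where
        i≤p : i ≤ p
        i≤p = ≤-pred (<-≤-trans (subst (i <_) i+d≡j (m<m+n i (s≤s z≤n))) j≤)

    -- Returning from P_j along the ear and then from z fits the budget M + (K − j).
    return-budget : ∀ j → j ≤ p → (p ∸ j) + (M + βz) ≤ M + (K ∸ j)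
    return-budget j j≤p = begin
      (p ∸ j) + (M + βz)        ≤⟨ +-monoʳ-≤ (p ∸ j) (+-monoʳ-≤ M βz≤) ⟩
      (p ∸ j) + (M + (K ∸ p))   ≡⟨ +-comm (p ∸ j) (M + (K ∸ p)) ⟩
      M + (K ∸ p) + (p ∸ j)     ≡⟨ +-assoc M (K ∸ p) (p ∸ j) ⟩
      M + ((K ∸ p) + (p ∸ j))   ≡⟨ cong (M +_) (≡-sym (+-∸-assoc (K ∸ p) j≤p)) ⟩
      M + ((K ∸ p) + p ∸ j)     ≡⟨ cong (λ k → M + (k ∸ j)) (m∸n+n≡m p≤K) ⟩
      M + (K ∸ j)               ∎
      where open ≤-Reasoning

    -- x reaches P_j through s and the first j + 1 ear arcs; P_j returns to
    -- x along the ear to z and then from z. Its distance to the seeds is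
    -- controlled by `vertex-far`.
    new-slack : ∀ j → j < p → Slack Oriented′ S M (at j)
    new-slack j j<p = record
      { α = suc j ; β = K ∸ j
      ; α≤g′ = ≤-trans j<p (≤-trans p≤K K≤g′)
      ; β≤g′ = ≤-trans (m∸n≤m K j) K≤g′
      ; from-x = dist-trans (dist-map old-arc (proj₁ (seeds-close s s∈S)))
                            (suc j , ≤-refl , ear-walk (suc j) 0 (suc j) refl (s≤s (<⇒≤ j<p)))
      ; to-x = dist-weaken (return-budget j (<⇒≤ j<p))
                 (dist-trans (p ∸ j , ≤-refl ,
                              ear-walk (p ∸ j) (suc j) (suc p) (cong suc (m+[n∸m]≡n (<⇒≤ j<p))) ≤-refl)
                             (dist-map old-arc z→x))
      ; far = vertex-far j (≤-trans (<⇒≤ j<p) p≤K)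
      }

    extended : PhaseState S M
    extended = record
      { explored      = explored′
      ; seeds-reached = λ u u∈S → old-reached (seeds-reached u u∈S)
      ; seeds-close   = λ u u∈S → ×-map (dist-map old-arc) (dist-map old-arc) (seeds-close u u∈S)
      ; slack         = λ u r → slack′ u (toWitness r)
      }
      where
        slack′ : ∀ u → Reached u ⊎ NewVertex u → Slack Oriented′ S M u
        slack′ u (inj₁ r)                = slack-map old-arc (slack u r)
        slack′ _ (inj₂ (j , j<p , refl)) = new-slack j j<p

    y-reached : T (reached′ y)
    y-reached = fromWitness (inj₂ (0 , 1≤p , vertexAt-start P))

  module Growth (ears : ∀ s y → Adj G s y → Walk (AdjMinus G s y) y s g′) where

    -- Every unreached neighbour y of a seed s can be reached by adding an
    -- ear, oriented forwards or backwards according to the slacks of its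
    -- first reached vertex z: since z is within K − p of the seeds,
    -- min(α_z, β_z) ≤ K − p.
    ear-step : ∀ {S M} (st : PhaseState S M) {s y} → T (S s) → Adj G s y → ¬ PhaseState.Reached st y →
               Σ (PhaseState S M) λ st′ →
                 PhaseState.reached st ⊆ᵇ PhaseState.reached st′ × PhaseState.Reached st′ y
    ear-step {S} {M} st {s} {y} s∈S sy y-new
      with leastWitness (λ L → reachable? (minus? G s y) S L y) g′ (s , s∈S , ears s y sy)
    ... | K , K≤g′ , (t , t∈S , P) , no-shorter
      with leastWitness (λ j → T? (PhaseState.reached st (vertexAt P j))) K
                        (subst (PhaseState.Reached st) (≡-sym (vertexAt-end P)) (PhaseState.seeds-reached st t t∈S))
    ... | p , p≤K , p-reached , p-first
      with PhaseState.slack st (vertexAt P p) p-reached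
    ... | σ with Slack.β σ ≤? K ∸ p
    ...   | yes β≤ = Forward.extended , (λ _ → Forward.old-reached) , Forward.y-reached
      where
        module Forward = AddEar st s∈S sy y-new P t∈S no-shorter K≤g′ p≤K p-reached p-first β≤ (Slack.to-x σ)
    ...   | no β≰ = reverse-phase Backward.extended , (λ _ → Backward.old-reached) , Backward.y-reached
      where
        α≤ : Slack.α σ ≤ K ∸ p
        α≤ = ⊓-≤-left _ _ _ (Slack.far σ (K ∸ p) t t∈S (mapʷ proj₁ (suffixʷ P p p≤K))) β≰
        module Backward = AddEar (reverse-phase st) s∈S sy y-new P t∈S no-shorter K≤g′ p≤K p-reached p-first
                                 α≤ (dist-reverse (Slack.from-x σ))

    Settled : (S D : Fin n → Bool) → Fin n → Set
    Settled S D y = T (D y) ⊎ ¬ (∃ λ s → T (S s) × Adj G s y)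

    settled-grows : ∀ {S D D′ y} → D ⊆ᵇ D′ → Settled S D y → Settled S D′ y
    settled-grows D⊆D′ (inj₁ r)    = inj₁ (D⊆D′ _ r)
    settled-grows _     (inj₂ none) = inj₂ none

    settle : ∀ {S M} (st : PhaseState S M) y → Σ (PhaseState S M) λ st′ →
             PhaseState.reached st ⊆ᵇ PhaseState.reached st′ × Settled S (PhaseState.reached st′) y
    settle {S} st y with T? (PhaseState.reached st y)
    ... | yes r = st , (λ _ r → r) , inj₁ r
    ... | no y-new with any? (λ s → T? (S s) ×-dec T? (adj G s y))
    ...   | no none = st , (λ _ r → r) , inj₂ none
    ...   | yes (s , s∈S , sy) with ear-step st s∈S sy y-new
    ...     | st′ , grows , y-reached = st′ , grows , inj₁ y-reached

    sweep : ∀ {S M} (ys : List (Fin n)) (st : PhaseState S M) → Σ (PhaseState S M) λ st′ →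
            PhaseState.reached st ⊆ᵇ PhaseState.reached st′ × (∀ y → y ∈ ys → Settled S (PhaseState.reached st′) y)
    sweep []       st = st , (λ _ r → r) , λ _ ()
    sweep (y ∷ ys) st with settle st y
    ... | st₁ , grows₁ , settled-y with sweep ys st₁
    ...   | st₂ , grows₂ , settled-ys = st₂ , (λ u r → grows₂ u (grows₁ u r)) , settled
      where
        settled : ∀ y′ → y′ ∈ y ∷ ys → Settled _ (PhaseState.reached st₂) y′
        settled _  (∈-here refl)   = settled-grows grows₂ settled-y
        settled y′ (∈-there y′∈ys) = settled-ys y′ y′∈ys

    record RoundState (m : ℕ) : Set where
      field
        explored : Explored
      open Explored explored public
      field
        close : ∀ u → Reached u → DistLe Oriented x u (m * g′) × DistLe Oriented u x (m * g′)
        ball  : ∀ u k → k ≤ m → Walk (Adj G) x u k → Reached u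

    initial : RoundState 0
    initial = record
      { explored = record
          { reached          = λ u → ⌊ u ≟ᶠ x ⌋
          ; oriented         = λ _ _ → false
          ; oriented⇒adj     = λ _ _ ()
          ; oriented⇒reached = λ _ _ ()
          ; oriented-antisym = λ _ _ ()
          }
      ; close = λ u u≡x → (0 , z≤n , at-x u≡x) , (0 , z≤n , reverseʷ (at-x u≡x))
      ; ball  = λ u k k≤0 w → fromWitness (≡-sym (walk-length-zero (subst (Walk (Adj G) x u) (n≤0⇒n≡0 k≤0) w)))
      }
      where
        at-x : ∀ {R : Fin n → Fin n → Set} {u} → T ⌊ u ≟ᶠ x ⌋ → Walk R x u 0
        at-x {R} u≡x = subst (λ v → Walk R x v 0) (≡-sym (toWitness u≡x)) here

    -- A round is a phase whose seeds are all vertices reached so far, at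
    -- slack 0, ...
    start-phase : ∀ {m} (rs : RoundState m) → PhaseState (RoundState.reached rs) (m * g′)
    start-phase {m} rs = record
      { explored      = explored
      ; seeds-reached = λ _ r → r
      ; seeds-close   = close
      ; slack         = λ u r → record
          { α = 0 ; β = 0 ; α≤g′ = z≤n ; β≤g′ = z≤n
          ; from-x = dist-weaken (m≤m+n (m * g′) 0) (proj₁ (close u r))
          ; to-x   = dist-weaken (m≤m+n (m * g′) 0) (proj₂ (close u r))
          ; far    = λ _ _ _ _ → z≤n }
      }
      where open RoundState rs

    -- ... and once every vertex is settled, the ball grows by one and the
    -- slacks ≤ g′ put every reached vertex within (m + 1)·g′ of x.
    end-phase : ∀ {m} (rs : RoundState m) (st : PhaseState (RoundState.reached rs) (m * g′)) →
                RoundState.reached rs ⊆ᵇ PhaseState.reached st →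
                (∀ y → Settled (RoundState.reached rs) (PhaseState.reached st) y) → RoundState (suc m)
    end-phase {m} rs st grows settled = record
      { explored = PhaseState.explored st
      ; close    = λ u r → let σ = PhaseState.slack st u r in
                     dist-weaken (round-budget m g′ (Slack.α≤g′ σ)) (Slack.from-x σ) ,
                     dist-weaken (round-budget m g′ (Slack.β≤g′ σ)) (Slack.to-x σ)
      ; ball     = ball′
      }
      where
        ball′ : ∀ u k → k ≤ suc m → Walk (Adj G) x u k → PhaseState.Reached st u
        ball′ u k k≤1+m w with m≤n⇒m<n∨m≡n k≤1+m
        ... | inj₁ k<1+m = grows u (RoundState.ball rs u k (≤-pred k<1+m) w)
        ... | inj₂ refl with unsnocʷ w | settled u
        ...   | _ , _ , _  | inj₁ r    = r
        ...   | v , w′ , vu | inj₂ none = ⊥-elim (none (v , RoundState.ball rs v m ≤-refl w′ , vu))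

    rounds : ∀ m → RoundState m
    rounds zero    = initial
    rounds (suc m) with sweep (allFin n) (start-phase (rounds m))
    ... | st , grows , settled = end-phase (rounds m) st grows (λ y → settled y (∈-allFin y))

    centred-orientation : ∀ r → EccLe (Adj G) x r →
      Σ (Orientation G) λ H → ∀ u → DistLe (Arc H) x u (r * g′) × DistLe (Arc H) u x (r * g′)
    centred-orientation r ecc = H , λ u → ×-map (dist-map extends) (dist-map extends) (close u (all-reached u))
      where
        open RoundState (rounds r)
        completion : Σ (Orientation G) λ H → ∀ u v → Oriented u v → Arc H u v
        completion = complete-orientation G oriented oriented⇒adj oriented-antisym
        H : Orientation G
        H = proj₁ completion
        extends : ∀ {u v} → Oriented u v → Arc H u v
        extends = proj₂ completion _ _
        all-reached : ∀ u → Reached u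
        all-reached u with ecc u
        ... | k , k≤r , w = ball u k k≤r w

double : ∀ r g → r * g + r * g ≡ 2 * r * g
double r g = begin
  r * g + r * g        ≡⟨ cong (r * g +_) (≡-sym (+-identityʳ (r * g))) ⟩
  2 * (r * g)          ≡⟨ ≡-sym (*-assoc 2 r g) ⟩
  2 * r * g            ∎
  where open ≡-Reasoning

theorem6 : ∀ {n} (G : Graph n) → Connected G → Bridgeless G → EdgeTransitive G → HasEdge G →
    ∀ r g → IsRadius G r → IsGirth G g →
    Σ (Orientation G) λ H → RadLe (Arc H) (r * (g ∸ 1)) × DiamLe (Arc H) (2 * r * (g ∸ 1))
theorem6 G _ _ edge-transitive _ r g ((x , ecc) , _) (cycle , _) =
    H
  , (x , λ u → proj₁ (close u))
  , λ u v → dist-weaken (≤-reflexive (double r (g ∸ 1))) (dist-trans (proj₂ (close u)) (proj₁ (close v)))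
  where
    open Construction G x (g ∸ 1)
    open Growth (λ s y sy → edge-ear G edge-transitive cycle sy)
    H : Orientation G
    H = proj₁ (centred-orientation r ecc)
    close : ∀ u → DistLe (Arc H) x u (r * (g ∸ 1)) × DistLe (Arc H) u x (r * (g ∸ 1))
    close = proj₂ (centred-orientation r ecc)
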